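{- Let $n\ge1$ and let $w_2(n)$ denote the binary weight of $n$ (number of nonzero binary digits). Then every simple two-dimensional lattice path of length $n$ satisfies \[ n + [\![ n > 1]\!] \leq X_{n}^{L} \leq 2n - w_{2}(n) \leq 2n - 1, \] and the first two bounds are sharp, i.e. for each $n$ they are attained by some path of length $n$.
   Context: A simple two-dimensional lattice path of length $n\ge1$ is a word of length $n$ over $\{\uparrow,\rightarrow,\downarrow,\leftarrow\}$. Horizontal steps are $\rightarrow,\leftarrow$, vertical steps $\uparrow,\downarrow$. The reduction $\Phi_L$ on paths of length $\ge2$: (1) if the path starts with a vertical step, rotate the whole path by $90^\circ$ clockwise; (2) if the resulting path ends with a horizontal step, rotate that last step by $90^\circ$ clockwise; the path then decomposes uniquely into segments, each a nonempty run of horizontal steps followed by a nonempty run of vertical steps; (3) replace each segment by $\nearrow$ (starts with $\rightarrow$, first vertical step $\uparrow$), $\searrow$ ($\rightarrow$, $\downarrow$), $\swarrow$ ($\leftarrow$, $\downarrow$), or $\nwarrow$ ($\leftarrow$, $\uparrow$); (4) rotate by $45^\circ$ clockwise: $\nearrow\mapsto\rightarrow$, $\searrow\mapsto\downarrow$, $\swarrow\mapsto\leftarrow$, $\nwarrow\mapsto\uparrow$. $\Phi_L$ is undefined on single steps. The $r$th fringe size of a path $\ell$ is the length of $\Phi_L^r(\ell)$ if $\Phi_L$ can be applied $r$ times to $\ell$, and $0$ otherwise. $X^L_n$ is the total fringe size, i.e. the sum over $r\ge0$ of the $r$th fringe sizes of a path of length $n$. $[\![P]\!]$ is $1$ if $P$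 holds and $0$ otherwise. -}

module Defs where

open import Data.Bool using (Bool; true; false; if_then_else_)
open import Data.Nat using (ℕ; zero; suc; _+_; _%_; ⌊_/2⌋)
open import Data.List using (List; []; _∷_; length; map)
open import Data.Maybe using (Maybe; just; nothing; maybe)
open import Relation.Nullary using (Dec; yes; no)

data Step : Set where
  up right down left : Step

Path : Set
Path = List Step

horizontal : Step → Bool
horizontal right = true
horizontal left  = true
horizontal up    = false
horizontal down  = false

rot : Step → Step
rot up    = right
rot right = down
rot down  = left
rot left  = up

normStart : Path → Path
normStart []      = []
normStart (s ∷ p) = if horizontal s then s ∷ p else map rot (s ∷ p)

normEnd : Path → Path
normEnd []          = []
normEnd (s ∷ [])    = (if horizontal s then rot s else s) ∷ []
normEnd (s ∷ t ∷ p) = s ∷ normEnd (t ∷ p)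

-- Steps (3)+(4): a segment whose horizontal run starts with h and whose
-- vertical run starts with v is replaced by ↗ ↘ ↙ ↖, then rotated by 45°:
-- ↗ ↦ →, ↘ ↦ ↓, ↙ ↦ ←, ↖ ↦ ↑.
segStep : Step → Step → Step
segStep right up   = right
segStep right down = down
segStep left  down = left
segStep left  up   = up
-- unreachable combinations (h is horizontal, v vertical in every use)
segStep h     v    = h

mutual
  -- inside the horizontal run of a segment whose first step is h
  inH : Step → Path → Path
  inH h []      = []
  inH h (s ∷ p) = if horizontal s then inH h p else segStep h s ∷ inV p

  -- inside a vertical run (or at the very start): the next horizontal step
  -- starts a new segment
  inV : Path → Path
  inV []      = []
  inV (s ∷ p) = if horizontal s then inH s p else inV p

-- Φ_L on a path of length ≥ 2 (no side condition on the argument here;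
-- the partiality is handled by ΦL below)
reduce : Path → Path
reduce p = inV (normEnd (normStart p))

ΦL : Path → Maybe Path
ΦL []          = nothing
ΦL (_ ∷ [])    = nothing
ΦL (s ∷ t ∷ p) = just (reduce (s ∷ t ∷ p))

iterΦL : ℕ → Path → Maybe Path
iterΦL zero    ℓ = just ℓ
iterΦL (suc r) ℓ with iterΦL r ℓ
... | nothing = nothing
... | just ℓ' = ΦL ℓ'

fringe : ℕ → Path → ℕ
fringe r ℓ = maybe length 0 (iterΦL r ℓ)

sumFringe : ℕ → Path → ℕ
sumFringe zero    ℓ = 0
sumFringe (suc k) ℓ = sumFringe k ℓ + fringe k ℓ

-- total fringe size X^L(ℓ) = Σ_{r ≥ 0} fringe r ℓ.  Since Φ_L strictly
-- decreases length, fringe r ℓ = 0 for r ≥ length ℓ, so the sum over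
-- r < length ℓ + 1 is the full (finite) sum.
X : Path → ℕ
X ℓ = sumFringe (suc (length ℓ)) ℓ

-- binary weight: number of 1 digits in the binary expansion
-- (fuel-based; fuel m suffices for any argument ≤ m)
weightAux : ℕ → ℕ → ℕ
weightAux zero    m = 0
weightAux (suc f) m = m % 2 + weightAux f ⌊ m /2⌋

w₂ : ℕ → ℕ
w₂ n = weightAux n n

⟦_⟧ : ∀ {a} {P : Set a} → Dec P → ℕ
⟦ yes _ ⟧ = 1
⟦ no  _ ⟧ = 0

-- Φ_L turns a path of length n ≥ 2 into one of length k with 1 ≤ k and 2k ≤ n
-- (each output step comes from a segment of at least two steps), and
-- X ℓ = n + X (Φ_L ℓ).  The lower bound follows from X ≥ length.  For the
-- upper bound write n = b + 2h with b ≤ 1, so that w₂ n = b + w₂ h and k ≤ h;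
-- as m ↦ 2m − w₂ m is nondecreasing, induction gives
-- X ℓ ≤ n + (2h − w₂ h) = 2n − w₂ n.  Both bounds are attained by paths built
-- backwards: replacing every step of ℓ by a two-step segment that Φ_L maps to
-- it, and appending b vertical steps, gives a path of length b + 2|ℓ| that
-- reduces to ℓ.
module Submission where

open import Data.Bool using (false)
open import Data.List using ([]; _∷_; length; map; replicate)
open import Data.List.Properties using (length-map; length-replicate)
open import Data.Maybe using (just; nothing; maybe; _>>=_)
open import Data.Nat
open import Data.Nat.Induction using (<-wellFounded)
open import Data.Nat.Properties
open import Algebra.Properties.CommutativeSemigroup +-commutativeSemigroup
  using (xy∙z≈xz∙y; x∙yz≈y∙xz)
open import Data.Product using (Σ-syntax; _×_; _,_)
open import Function using (_∘_)
open import Induction.WellFounded using (Acc; acc)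
open import Relation.Binary.PropositionalEquality

open import Defs

data Binary : ℕ → Set where
  0b  : Binary 0
  bit : ∀ {h} b → b ≤ 1 → Binary h → Binary (b + (h + h))

increment : ∀ {n} → Binary n → Binary (suc n)
increment 0b                             = bit 1 ≤-refl 0b
increment (bit 0 _ v)                    = bit 1 ≤-refl v
increment (bit {h} 1 _ v)                =
  subst Binary (cong suc (+-suc h h)) (bit 0 z≤n (increment v))
increment (bit (suc (suc _)) (s≤s ()) _)

binary : ∀ n → Binary n
binary zero    = 0b
binary (suc n) = increment (binary n)

weightAux-fuel : ∀ {f g m} → m ≤ f → m ≤ g → weightAux f m ≡ weightAux g m
weightAux-fuel {zero}  {zero}  z≤n z≤n = refl
weightAux-fuel {zero}  {suc g} z≤n z≤n = sym (weightAux-fuel {g} {zero} z≤n z≤n)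
weightAux-fuel {suc f} {zero}  z≤n z≤n = weightAux-fuel {f} {zero} z≤n z≤n
weightAux-fuel {suc f} {suc g} {m} m≤1+f m≤1+g =
  cong (m % 2 +_) (weightAux-fuel (halve≤ m≤1+f) (halve≤ m≤1+g))
  where
  halve≤ : ∀ {k} → m ≤ suc k → ⌊ m /2⌋ ≤ k
  halve≤ {k} m≤1+k = ≤-trans (⌊n/2⌋-mono m≤1+k) (≤-pred (⌊n/2⌋<n k))

w₂-suc : ∀ m → w₂ (suc m) ≡ suc m % 2 + w₂ ⌊ suc m /2⌋
w₂-suc m = cong (suc m % 2 +_) (weightAux-fuel (≤-pred (⌊n/2⌋<n m)) ≤-refl)

⌊1+n+n/2⌋≡n : ∀ n → ⌊ suc (n + n) /2⌋ ≡ n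
⌊1+n+n/2⌋≡n zero    = refl
⌊1+n+n/2⌋≡n (suc n) = cong suc (trans (cong ⌊_/2⌋ (+-suc n n)) (⌊1+n+n/2⌋≡n n))

n+n%2≡0 : ∀ n → (n + n) % 2 ≡ 0
n+n%2≡0 zero    = refl
n+n%2≡0 (suc n) rewrite +-suc n n = n+n%2≡0 n

1+n+n%2≡1 : ∀ n → suc (n + n) % 2 ≡ 1
1+n+n%2≡1 zero    = refl
1+n+n%2≡1 (suc n) rewrite +-suc n n = 1+n+n%2≡1 n

w₂-double : ∀ h → w₂ (h + h) ≡ w₂ h
w₂-double zero    = refl
w₂-double (suc h) = begin
  w₂ (suc h + suc h)                            ≡⟨ w₂-suc (h + suc h) ⟩
  (suc h + suc h) % 2 + w₂ ⌊ suc h + suc h /2⌋  ≡⟨ cong₂ _+_ (n+n%2≡0 (suc h)) (cong w₂ (sym (n≡⌊n+n/2⌋ (suc h)))) ⟩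
  w₂ (suc h)                                    ∎
  where open ≡-Reasoning

w₂-double+1 : ∀ h → w₂ (suc (h + h)) ≡ suc (w₂ h)
w₂-double+1 h = begin
  w₂ (suc (h + h))                        ≡⟨ w₂-suc (h + h) ⟩
  suc (h + h) % 2 + w₂ ⌊ suc (h + h) /2⌋  ≡⟨ cong₂ _+_ (1+n+n%2≡1 h) (cong w₂ (⌊1+n+n/2⌋≡n h)) ⟩
  suc (w₂ h)                              ∎
  where open ≡-Reasoning

w₂-bit : ∀ {b} → b ≤ 1 → ∀ h → w₂ (b + (h + h)) ≡ b + w₂ h
w₂-bit z≤n       = w₂-double
w₂-bit (s≤s z≤n) = w₂-double+1

w₂-suc≤ : ∀ {n} → Binary n → w₂ (suc n) ≤ suc (w₂ n)
w₂-suc≤ 0b              = ≤-refl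
w₂-suc≤ (bit {h} 0 _ _) = ≤-reflexive (trans (w₂-double+1 h) (cong suc (sym (w₂-double h))))
w₂-suc≤ (bit {h} 1 _ v) = begin
  w₂ (suc (suc (h + h)))  ≡⟨ cong w₂ (cong suc (sym (+-suc h h))) ⟩
  w₂ (suc h + suc h)      ≡⟨ w₂-double (suc h) ⟩
  w₂ (suc h)              ≤⟨ w₂-suc≤ v ⟩
  suc (w₂ h)              ≤⟨ n≤1+n _ ⟩
  suc (suc (w₂ h))        ≡⟨ cong suc (sym (w₂-double+1 h)) ⟩
  suc (w₂ (suc (h + h)))  ∎
  where open ≤-Reasoning
w₂-suc≤ (bit (suc (suc _)) (s≤s ()) _)

w₂-positive : ∀ {n} → Binary n → 1 ≤ n → 1 ≤ w₂ n
w₂-positive (bit {h} 1 _ _)     _ = subst (1 ≤_) (sym (w₂-double+1 h)) (s≤s z≤n)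
w₂-positive (bit {suc h} 0 _ v) _ = subst (1 ≤_) (sym (w₂-double (suc h))) (w₂-positive v (s≤s z≤n))
w₂-positive (bit (suc (suc _)) (s≤s ()) _) _

k≤h⇒k+k+w₂h≤h+h+w₂k : ∀ {k h} → k ≤ h → (k + k) + w₂ h ≤ (h + h) + w₂ k
k≤h⇒k+k+w₂h≤h+h+w₂k {k} {h} k≤h = go (≤⇒≤′ k≤h)
  where
  open ≤-Reasoning
  go : ∀ {m} → k ≤′ m → (k + k) + w₂ m ≤ (m + m) + w₂ k
  go ≤′-refl = ≤-refl
  go (≤′-step {m} k≤′m) = begin
    (k + k) + w₂ (suc m)        ≤⟨ +-monoʳ-≤ (k + k) (w₂-suc≤ (binary m)) ⟩
    (k + k) + suc (w₂ m)        ≡⟨ +-suc (k + k) (w₂ m) ⟩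
    suc ((k + k) + w₂ m)        ≤⟨ s≤s (go k≤′m) ⟩
    suc ((m + m) + w₂ k)        ≤⟨ n≤1+n _ ⟩
    suc (suc ((m + m) + w₂ k))  ≡⟨ cong (λ x → suc x + w₂ k) (sym (+-suc m m)) ⟩
    (suc m + suc m) + w₂ k      ∎

length-normStart : ∀ p → length (normStart p) ≡ length p
length-normStart []          = refl
length-normStart (up ∷ p)    = cong suc (length-map rot p)
length-normStart (right ∷ p) = refl
length-normStart (down ∷ p)  = cong suc (length-map rot p)
length-normStart (left ∷ p)  = refl

length-normEnd : ∀ p → length (normEnd p) ≡ length p
length-normEnd []          = refl
length-normEnd (s ∷ [])    = refl
length-normEnd (s ∷ t ∷ p) = cong suc (length-normEnd (t ∷ p))

-- Every emitted step closes a segment of at least two steps.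
mutual
  inH-halves : ∀ h p → length (inH h p) + length (inH h p) ≤ suc (length p)
  inH-halves h []          = z≤n
  inH-halves h (up ∷ p)    = s≤s (subst (_≤ suc (length p)) (sym (+-suc _ _)) (s≤s (inV-halves p)))
  inH-halves h (down ∷ p)  = s≤s (subst (_≤ suc (length p)) (sym (+-suc _ _)) (s≤s (inV-halves p)))
  inH-halves h (right ∷ p) = m≤n⇒m≤1+n (inH-halves h p)
  inH-halves h (left ∷ p)  = m≤n⇒m≤1+n (inH-halves h p)

  inV-halves : ∀ p → length (inV p) + length (inV p) ≤ length p
  inV-halves []          = z≤n
  inV-halves (up ∷ p)    = m≤n⇒m≤1+n (inV-halves p)
  inV-halves (down ∷ p)  = m≤n⇒m≤1+n (inV-halves p)
  inV-halves (right ∷ p) = inH-halves right p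
  inV-halves (left ∷ p)  = inH-halves left p

reduce-halves : ∀ p → length (reduce p) + length (reduce p) ≤ length p
reduce-halves p = subst (length (reduce p) + length (reduce p) ≤_)
  (trans (length-normEnd (normStart p)) (length-normStart p))
  (inV-halves (normEnd (normStart p)))

-- normEnd makes the last step vertical, so the last segment is closed.
inH-normEnd-nonEmpty : ∀ h t p → 0 < length (inH h (normEnd (t ∷ p)))
inH-normEnd-nonEmpty h up    []      = s≤s z≤n
inH-normEnd-nonEmpty h right []      = s≤s z≤n
inH-normEnd-nonEmpty h down  []      = s≤s z≤n
inH-normEnd-nonEmpty h left  []      = s≤s z≤n
inH-normEnd-nonEmpty h up    (u ∷ p) = s≤s z≤n
inH-normEnd-nonEmpty h down  (u ∷ p) = s≤s z≤n
inH-normEnd-nonEmpty h right (u ∷ p) = inH-normEnd-nonEmpty h u p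
inH-normEnd-nonEmpty h left  (u ∷ p) = inH-normEnd-nonEmpty h u p

reduce-nonEmpty : ∀ s t p → 0 < length (reduce (s ∷ t ∷ p))
reduce-nonEmpty up    t p = inH-normEnd-nonEmpty right (rot t) (map rot p)
reduce-nonEmpty right t p = inH-normEnd-nonEmpty right t p
reduce-nonEmpty down  t p = inH-normEnd-nonEmpty left (rot t) (map rot p)
reduce-nonEmpty left  t p = inH-normEnd-nonEmpty left t p

length-reduce< : ∀ s t p → length (reduce (s ∷ t ∷ p)) < length (s ∷ t ∷ p)
length-reduce< s t p = <-≤-trans (m<m+n _ (reduce-nonEmpty s t p)) (reduce-halves (s ∷ t ∷ p))

iterΦL-suc : ∀ r ℓ → iterΦL (suc r) ℓ ≡ (iterΦL r ℓ >>= ΦL)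
iterΦL-suc r ℓ with iterΦL r ℓ
... | nothing = refl
... | just _  = refl

iterΦL-sucˡ : ∀ r ℓ → iterΦL (suc r) ℓ ≡ (ΦL ℓ >>= iterΦL r)
iterΦL-sucˡ zero ℓ with ΦL ℓ
... | nothing = refl
... | just _  = refl
iterΦL-sucˡ (suc r) ℓ = begin
  iterΦL (suc (suc r)) ℓ      ≡⟨ iterΦL-suc (suc r) ℓ ⟩
  (iterΦL (suc r) ℓ >>= ΦL)   ≡⟨ cong (_>>= ΦL) (iterΦL-sucˡ r ℓ) ⟩
  (ΦL ℓ >>= iterΦL r >>= ΦL)  ≡⟨ reassociate (ΦL ℓ) ⟩
  (ΦL ℓ >>= iterΦL (suc r))   ∎
  where
  open ≡-Reasoning
  reassociate : ∀ m → (m >>= iterΦL r >>= ΦL) ≡ (m >>= iterΦL (suc r))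
  reassociate nothing  = refl
  reassociate (just q) = sym (iterΦL-suc r q)

fringe-suc : ∀ r ℓ → fringe (suc r) ℓ ≡ maybe length 0 (ΦL ℓ >>= iterΦL r)
fringe-suc r ℓ = cong (maybe length 0) (iterΦL-sucˡ r ℓ)

fringe-vanishes : ∀ r q → length q < r → fringe r q ≡ 0
fringe-vanishes (suc r) []          _       = fringe-suc r []
fringe-vanishes (suc r) (s ∷ [])    _       = fringe-suc r (s ∷ [])
fringe-vanishes (suc r) (s ∷ t ∷ p) |q|<1+r = trans (fringe-suc r (s ∷ t ∷ p))
  (fringe-vanishes r _ (<-≤-trans (length-reduce< s t p) (≤-pred |q|<1+r)))

sumFringe-suc : ∀ k s t p → let ℓ = s ∷ t ∷ p in
  sumFringe (suc k) ℓ ≡ length ℓ + sumFringe k (reduce ℓ)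
sumFringe-suc zero    s t p = +-comm 0 (length (s ∷ t ∷ p))
sumFringe-suc (suc k) s t p = begin
  sumFringe (suc k) ℓ + fringe (suc k) ℓ                     ≡⟨ cong₂ _+_ (sumFringe-suc k s t p) (fringe-suc k ℓ) ⟩
  (length ℓ + sumFringe k (reduce ℓ)) + fringe k (reduce ℓ)  ≡⟨ +-assoc (length ℓ) _ _ ⟩
  length ℓ + sumFringe (suc k) (reduce ℓ)                    ∎
  where
  open ≡-Reasoning
  ℓ = s ∷ t ∷ p

sumFringe-saturates : ∀ j q → sumFringe (j + suc (length q)) q ≡ X q
sumFringe-saturates zero    q = refl
sumFringe-saturates (suc j) q = trans
  (cong₂ _+_ (sumFringe-saturates j q) (fringe-vanishes (j + suc (length q)) q (m≤n+m _ j)))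
  (+-identityʳ (X q))

X-∷∷ : ∀ s t p → X (s ∷ t ∷ p) ≡ length (s ∷ t ∷ p) + X (reduce (s ∷ t ∷ p))
X-∷∷ s t p = begin
  X ℓ                                          ≡⟨ sumFringe-suc (length ℓ) s t p ⟩
  length ℓ + sumFringe (length ℓ) q            ≡⟨ cong (λ k → length ℓ + sumFringe k q) (sym (m∸n+n≡m (length-reduce< s t p))) ⟩
  length ℓ + sumFringe (j + suc (length q)) q  ≡⟨ cong (length ℓ +_) (sumFringe-saturates j q) ⟩
  length ℓ + X q                               ∎
  where
  open ≡-Reasoning
  ℓ = s ∷ t ∷ p
  q = reduce ℓ
  j = length ℓ ∸ suc (length q)

k+k≤b+[h+h]⇒k≤h : ∀ {b k h} → b ≤ 1 → k + k ≤ b + (h + h) → k ≤ h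
k+k≤b+[h+h]⇒k≤h {b} {k} {h} b≤1 k+k≤n = begin
  k                  ≡⟨ n≡⌊n+n/2⌋ k ⟩
  ⌊ k + k /2⌋        ≤⟨ ⌊n/2⌋-mono (≤-trans k+k≤n (+-monoˡ-≤ (h + h) b≤1)) ⟩
  ⌊ suc (h + h) /2⌋  ≡⟨ ⌊1+n+n/2⌋≡n h ⟩
  h                  ∎
  where open ≤-Reasoning

w₂-bound-step : ∀ {n} → Binary n → ∀ {k x} → k + k ≤ n → x + w₂ k ≤ k + k → (n + x) + w₂ n ≤ n + n
w₂-bound-step 0b {zero} z≤n x≤0 = x≤0
w₂-bound-step (bit {h} b b≤1 _) {k} {x} k+k≤n x+w₂k≤k+k = begin
  (n + x) + w₂ n          ≡⟨ cong ((n + x) +_) (w₂-bit b≤1 h) ⟩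
  (n + x) + (b + w₂ h)    ≡⟨ +-assoc n x (b + w₂ h) ⟩
  n + (x + (b + w₂ h))    ≡⟨ cong (n +_) (x∙yz≈y∙xz x b (w₂ h)) ⟩
  n + (b + (x + w₂ h))    ≤⟨ +-monoʳ-≤ n (+-monoʳ-≤ b x+w₂h≤h+h) ⟩
  n + n                   ∎
  where
  open ≤-Reasoning
  n = b + (h + h)
  x+w₂h≤h+h : x + w₂ h ≤ h + h
  x+w₂h≤h+h = +-cancelʳ-≤ (w₂ k) (x + w₂ h) (h + h) (begin
    (x + w₂ h) + w₂ k  ≡⟨ xy∙z≈xz∙y x (w₂ h) (w₂ k) ⟩
    (x + w₂ k) + w₂ h  ≤⟨ +-monoˡ-≤ (w₂ h) x+w₂k≤k+k ⟩
    (k + k) + w₂ h     ≤⟨ k≤h⇒k+k+w₂h≤h+h+w₂k {k} {h} (k+k≤b+[h+h]⇒k≤h b≤1 k+k≤n) ⟩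
    (h + h) + w₂ k     ∎)

X+w₂≤length+length : ∀ ℓ → X ℓ + w₂ (length ℓ) ≤ length ℓ + length ℓ
X+w₂≤length+length p = go p (<-wellFounded (length p))
  where
  go : ∀ ℓ → Acc _<_ (length ℓ) → X ℓ + w₂ (length ℓ) ≤ length ℓ + length ℓ
  go []          _        = z≤n
  go (s ∷ [])    _        = ≤-refl
  go (s ∷ t ∷ p) (acc rs) =
    subst (λ x → x + w₂ (length ℓ) ≤ length ℓ + length ℓ) (sym (X-∷∷ s t p))
      (w₂-bound-step (binary (length ℓ)) {length (reduce ℓ)} {X (reduce ℓ)}
        (reduce-halves ℓ) (go (reduce ℓ) (rs (length-reduce< s t p))))
    where ℓ = s ∷ t ∷ p

length≤X : ∀ ℓ → length ℓ ≤ X ℓ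
length≤X []          = z≤n
length≤X (s ∷ [])    = ≤-refl
length≤X (s ∷ t ∷ p) = subst (length (s ∷ t ∷ p) ≤_) (sym (X-∷∷ s t p)) (m≤m+n _ _)

segmentH segmentV : Step → Step
segmentH up    = left
segmentH right = right
segmentH down  = right
segmentH left  = left
segmentV up    = up
segmentV right = up
segmentV down  = down
segmentV left  = down

preimage : ℕ → Path → Path
preimage m []      = replicate m up
preimage m (s ∷ q) = segmentH s ∷ segmentV s ∷ preimage m q

length-preimage : ∀ m q → length (preimage m q) ≡ m + (length q + length q)
length-preimage m []      = trans (length-replicate m) (sym (+-identityʳ m))
length-preimage m (s ∷ q) = begin
  suc (suc (length (preimage m q)))      ≡⟨ cong (λ k → suc (suc k)) (length-preimage m q) ⟩
  suc (suc (m + (length q + length q)))  ≡⟨ cong suc (sym (+-suc m _)) ⟩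
  suc (m + suc (length q + length q))    ≡⟨ sym (+-suc m _) ⟩
  m + suc (suc (length q + length q))    ≡⟨ cong (λ k → m + suc k) (sym (+-suc (length q) (length q))) ⟩
  m + (suc (length q) + suc (length q))  ∎
  where open ≡-Reasoning

normEnd-vertical∷ups : ∀ {v} → horizontal v ≡ false → ∀ m → normEnd (v ∷ replicate m up) ≡ v ∷ replicate m up
normEnd-vertical∷ups v-vert zero    rewrite v-vert = refl
normEnd-vertical∷ups _      (suc m) = cong (_ ∷_) (normEnd-vertical∷ups refl m)

segmentV-vertical : ∀ s → horizontal (segmentV s) ≡ false
segmentV-vertical up    = refl
segmentV-vertical right = refl
segmentV-vertical down  = refl
segmentV-vertical left  = refl

normEnd-segmentV∷preimage : ∀ m s q → normEnd (segmentV s ∷ preimage m q) ≡ segmentV s ∷ preimage m q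
normEnd-segmentV∷preimage m s []      = normEnd-vertical∷ups (segmentV-vertical s) m
normEnd-segmentV∷preimage m s (t ∷ q) = cong (λ p → segmentV s ∷ segmentH t ∷ p) (normEnd-segmentV∷preimage m t q)

normStart-segmentH∷ : ∀ s p → normStart (segmentH s ∷ p) ≡ segmentH s ∷ p
normStart-segmentH∷ up    p = refl
normStart-segmentH∷ right p = refl
normStart-segmentH∷ down  p = refl
normStart-segmentH∷ left  p = refl

inV-segment∷ : ∀ s p → inV (segmentH s ∷ segmentV s ∷ p) ≡ s ∷ inV p
inV-segment∷ up    p = refl
inV-segment∷ right p = refl
inV-segment∷ down  p = refl
inV-segment∷ left  p = refl

inV-preimage : ∀ m q → inV (preimage m q) ≡ q
inV-preimage zero    []      = refl
inV-preimage (suc m) []      = inV-preimage m []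
inV-preimage m       (s ∷ q) = trans (inV-segment∷ s (preimage m q)) (cong (s ∷_) (inV-preimage m q))

reduce-preimage : ∀ m s q → reduce (preimage m (s ∷ q)) ≡ s ∷ q
reduce-preimage m s q = begin
  inV (normEnd (normStart (preimage m (s ∷ q))))  ≡⟨ cong (inV ∘ normEnd) (normStart-segmentH∷ s _) ⟩
  inV (normEnd (preimage m (s ∷ q)))              ≡⟨ cong (λ p → inV (segmentH s ∷ p)) (normEnd-segmentV∷preimage m s q) ⟩
  inV (preimage m (s ∷ q))                        ≡⟨ inV-preimage m (s ∷ q) ⟩
  s ∷ q                                           ∎
  where open ≡-Reasoning

X-preimage : ∀ m s q → X (preimage m (s ∷ q)) ≡ length (preimage m (s ∷ q)) + X (s ∷ q)
X-preimage m s q = trans (X-∷∷ (segmentH s) (segmentV s) (preimage m q))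
  (cong (λ p → length (preimage m (s ∷ q)) + X p) (reduce-preimage m s q))

n+n≡2*n : ∀ n → n + n ≡ 2 * n
n+n≡2*n n = cong (n +_) (sym (+-identityʳ n))

X≤2*length∸w₂ : ∀ ℓ → X ℓ ≤ 2 * length ℓ ∸ w₂ (length ℓ)
X≤2*length∸w₂ ℓ = m+n≤o⇒m≤o∸n (X ℓ)
  (subst (X ℓ + w₂ (length ℓ) ≤_) (n+n≡2*n (length ℓ)) (X+w₂≤length+length ℓ))

length+[1<length]≤X : ∀ ℓ → 1 ≤ length ℓ → length ℓ + ⟦ 1 <? length ℓ ⟧ ≤ X ℓ
length+[1<length]≤X (s ∷ [])    _ = ≤-refl
length+[1<length]≤X (s ∷ t ∷ p) _ = subst (length (s ∷ t ∷ p) + 1 ≤_) (sym (X-∷∷ s t p))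
  (+-monoʳ-≤ (length (s ∷ t ∷ p)) (≤-trans (reduce-nonEmpty s t p) (length≤X (reduce (s ∷ t ∷ p)))))

X-lower-attained : ∀ n → 1 ≤ n → Σ[ ℓ ∈ Path ] (length ℓ ≡ n × X ℓ ≡ n + ⟦ 1 <? n ⟧)
X-lower-attained (suc zero)    _ = right ∷ [] , refl , refl
X-lower-attained (suc (suc k)) _ =
  preimage k (right ∷ []) , length≡n , trans (X-preimage k right []) (cong (_+ 1) length≡n)
  where
  length≡n : length (preimage k (right ∷ [])) ≡ suc (suc k)
  length≡n = trans (length-preimage k (right ∷ [])) (+-comm k 2)

UpperExtremal : ℕ → Set
UpperExtremal n = Σ[ ℓ ∈ Path ] (length ℓ ≡ n × X ℓ + w₂ n ≡ n + n)

upperExtremal : ∀ {n} → Binary n → UpperExtremal n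
upperExtremal 0b = [] , refl , refl
upperExtremal (bit b b≤1 v) with upperExtremal v
... | []    , refl , _ = atMostOne b≤1
  where
  atMostOne : ∀ {b} → b ≤ 1 → UpperExtremal (b + 0)
  atMostOne z≤n       = [] , refl , refl
  atMostOne (s≤s z≤n) = right ∷ [] , refl , refl
... | s ∷ q , refl , X+w₂≡h+h = preimage b (s ∷ q) , length-preimage b (s ∷ q) , (begin
  X (preimage b (s ∷ q)) + w₂ n      ≡⟨ cong₂ _+_ (trans (X-preimage b s q) (cong (_+ X (s ∷ q)) (length-preimage b (s ∷ q)))) (w₂-bit b≤1 h) ⟩
  (n + X (s ∷ q)) + (b + w₂ h)       ≡⟨ +-assoc n (X (s ∷ q)) (b + w₂ h) ⟩
  n + (X (s ∷ q) + (b + w₂ h))       ≡⟨ cong (n +_) (x∙yz≈y∙xz (X (s ∷ q)) b (w₂ h)) ⟩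
  n + (b + (X (s ∷ q) + w₂ h))       ≡⟨ cong (λ y → n + (b + y)) X+w₂≡h+h ⟩
  n + n                              ∎)
  where
  open ≡-Reasoning
  h = length (s ∷ q)
  n = b + (h + h)

X-upper-attained : ∀ n → Σ[ ℓ ∈ Path ] (length ℓ ≡ n × X ℓ ≡ 2 * n ∸ w₂ n)
X-upper-attained n with upperExtremal (binary n)
... | ℓ , length≡n , X+w₂≡n+n = ℓ , length≡n , (begin
  X ℓ                 ≡⟨ sym (m+n∸n≡m (X ℓ) (w₂ n)) ⟩
  X ℓ + w₂ n ∸ w₂ n   ≡⟨ cong (_∸ w₂ n) (trans X+w₂≡n+n (n+n≡2*n n)) ⟩
  2 * n ∸ w₂ n        ∎)
  where open ≡-Reasoning

proposition3p12 : (n : ℕ) → 1 ≤ n →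
    ((ℓ : Path) → length ℓ ≡ n →
    (n + ⟦ 1 <? n ⟧ ≤ X ℓ) × (X ℓ ≤ 2 * n ∸ w₂ n) × (2 * n ∸ w₂ n ≤ 2 * n ∸ 1))
    × (Σ[ ℓ ∈ Path ] (length ℓ ≡ n × X ℓ ≡ n + ⟦ 1 <? n ⟧))
    × (Σ[ ℓ ∈ Path ] (length ℓ ≡ n × X ℓ ≡ 2 * n ∸ w₂ n))
proposition3p12 n 1≤n = bounds , X-lower-attained n 1≤n , X-upper-attained n
  where
  bounds : (ℓ : Path) → length ℓ ≡ n →
    (n + ⟦ 1 <? n ⟧ ≤ X ℓ) × (X ℓ ≤ 2 * n ∸ w₂ n) × (2 * n ∸ w₂ n ≤ 2 * n ∸ 1)
  bounds ℓ refl =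
    length+[1<length]≤X ℓ 1≤n , X≤2*length∸w₂ ℓ , ∸-monoʳ-≤ (2 * n) (w₂-positive (binary n) 1≤n)
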